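{- Let $G$ be a $3$-edge-connected multigraph with DFS tree $\mathcal{T}$. If $e$ and $f$ are tree edges and $g$ is a non-tree edge such that $\{e,f,g\}$ is a $3$-edge-cut of $G$, then $e$ and $f$ are comparable with respect to $\le_{\mathcal{T}}$.
   Context: $G$ is $3$-edge-connected if it is connected and remains connected after removing any set of at most $2$ edges; a $3$-edge-cut is a set of $3$ edges whose removal disconnects $G$. A DFS tree $\mathcal{T}$ (rooted at the start vertex $r$) is the spanning tree of edges traversed by a depth-first search; the remaining edges are non-tree edges. The partial order $\le_{\mathcal{T}}$ on vertices and tree edges: $x\le_{\mathcal{T}}y$ if the path in $\mathcal{T}$ from $r$ to $y$ contains $x$. -}

module Defs where

open import Data.Nat using (ℕ)
open import Data.Fin using (Fin)
open import Data.Product using (_×_; _,_; Σ; ∃; ∃-syntax)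
open import Data.Sum using (_⊎_)
open import Data.List using (List; []; _∷_; _++_; [_])
open import Data.List.Membership.Propositional using (_∈_; _∉_)
open import Data.List.Relation.Unary.Unique.Propositional using (Unique)
open import Relation.Binary.PropositionalEquality using (_≡_; _≢_)
open import Relation.Binary.Construct.Closure.ReflexiveTransitive using (Star)
open import Relation.Nullary using (¬_)
open import Data.Empty using (⊥)

-- A finite multigraph: vertices Fin n, edges Fin m, each edge with an
-- (unordered) pair of endpoints.  Parallel edges and loops are allowed.
record Multigraph : Set where
  field
    n    : ℕ
    m    : ℕ
    ends : Fin m → Fin n × Fin n

module _ (G : Multigraph) where
  open Multigraph G

  Joins : Fin m → Fin n → Fin n → Set
  Joins e u w = (ends e ≡ (u , w)) ⊎ (ends e ≡ (w , u))

  data Reach (removed : Fin m → Set) : Fin n → Fin n → Set where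
    here : ∀ {u} → Reach removed u u
    step : ∀ {u w z} (e : Fin m) → ¬ removed e → Joins e u w →
           Reach removed w z → Reach removed u z

  ConnectedWithout : (Fin m → Set) → Set
  ConnectedWithout removed = ∀ u v → Reach removed u v


  Connected : Set
  Connected = ConnectedWithout (λ _ → ⊥)

  -- connected, and stays connected after removing any set of at most 2 edges
  -- (a set {e₁,e₂}; e₁ ≡ e₂ gives the one-element sets)
  ThreeEdgeConnected : Set
  ThreeEdgeConnected =
    Connected × (∀ e₁ e₂ → ConnectedWithout (λ x → (x ≡ e₁) ⊎ (x ≡ e₂)))

  ThreeEdgeCut : Fin m → Fin m → Fin m → Set
  ThreeEdgeCut e f g =
    e ≢ f × e ≢ g × f ≢ g ×
    ¬ ConnectedWithout (λ x → (x ≡ e) ⊎ (x ≡ f) ⊎ (x ≡ g))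

  -- Depth-first search (with arbitrary choice of the next neighbour).
  -- State: visited vertices, the DFS stack (top = current vertex),
  -- and the list of tree edges traversed so far.
  record DFSState : Set where
    constructor ⟨_,_,_⟩
    field
      visited : List (Fin n)
      stack   : List (Fin n)
      tree    : List (Fin m)

  data DFSStep : DFSState → DFSState → Set where
    advance : ∀ {vis u st T} (e : Fin m) (w : Fin n) →
              Joins e u w → w ∉ vis →
              DFSStep ⟨ vis , u ∷ st , T ⟩ ⟨ w ∷ vis , w ∷ u ∷ st , e ∷ T ⟩
    retreat : ∀ {vis u st T} →
              (∀ (e : Fin m) (w : Fin n) → Joins e u w → w ∈ vis) →
              DFSStep ⟨ vis , u ∷ st , T ⟩ ⟨ vis , st , T ⟩

  IsDFSTree : Fin n → List (Fin m) → Set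
  IsDFSTree r T =
    ∃[ vis ] Star DFSStep ⟨ r ∷ [] , r ∷ [] , [] ⟩ ⟨ vis , [] , T ⟩

  data TreePath (T : List (Fin m)) :
       Fin n → Fin n → List (Fin m) → List (Fin n) → Set where
    nil  : ∀ {x} → TreePath T x x [] (x ∷ [])
    cons : ∀ {x y z es vs} (e : Fin m) → e ∈ T → Joins e x y →
           TreePath T y z es vs → TreePath T x z (e ∷ es) (x ∷ vs)

  -- e ≤_T f for tree edges: the path in T from the root r to (and through)
  -- f contains e.  The path is simple (no repeated vertex), hence the
  -- unique tree path.
  EdgeLeT : Fin n → List (Fin m) → Fin m → Fin m → Set
  EdgeLeT r T e f =
    ∃[ z ] ∃[ es ] ∃[ vs ] ∃[ es′ ]
      TreePath T r z es vs × Unique vs × es ≡ es′ ++ [ f ] × e ∈ es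

  ComparableT : Fin n → List (Fin m) → Fin m → Fin m → Set
  ComparableT r T e f = EdgeLeT r T e f ⊎ EdgeLeT r T f e

{-# OPTIONS --safe #-}
-- Label every vertex x with the edge list of its root path in T.  Depth-first
-- search has no cross edges: the endpoints of every edge of G have comparable
-- labels.  If e and f were incomparable, no label would contain both, and G
-- minus {e, f, g} would still be connected: from a vertex below e take a path
-- to r avoiding e and g (3-edge-connectivity) and follow it until it first
-- leaves the subtree below e.  The edge used to leave is not f (its endpoints
-- lie below e or on the root path above e), and from there the tree path
-- climbs to r avoiding e, f and the non-tree edge g.
module Submission where

open import Defs
open import Data.Fin using (Fin; _≟_)
open import Data.Fin.Properties using (any?)
open import Data.Product using (_×_; _,_; ∃₂; ∃-syntax)
open import Data.Sum as Sum using (_⊎_; inj₁; inj₂)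
open import Data.List using (List; []; _∷_; _++_; [_])
open import Data.List.Properties using (++-identityʳ; ++-assoc)
open import Data.List.Membership.Propositional using (_∈_; _∉_)
open import Data.List.Membership.Propositional.Properties
  using (∈-++⁺ˡ; ∈-++⁺ʳ; ∈-++⁻; ∈-∃++)
import Data.List.Membership.DecPropositional as DecMembership
open import Data.List.Relation.Unary.Any using (here; there)
open import Data.List.Relation.Unary.All as All using (All; []; _∷_)
open import Data.List.Relation.Unary.All.Properties using (++⁻ˡ)
open import Data.List.Relation.Unary.AllPairs as AllPairs using (AllPairs; []; _∷_)
open import Data.List.Relation.Unary.Unique.Propositional using (Unique)
import Data.List.Relation.Unary.Unique.Propositional.Properties as Unique
open import Data.List.Relation.Binary.Subset.Propositional using (_⊆_)
open import Data.Vec.Functional using (updateAt)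
open import Data.Vec.Functional.Properties using (updateAt-updates; updateAt-minimal)
open import Relation.Binary.PropositionalEquality
  using (_≡_; _≢_; refl; sym; trans; cong; subst; subst₂)
open import Relation.Binary.Construct.Closure.ReflexiveTransitive using (Star; ε; _◅_)
open import Relation.Nullary using (¬_; yes; no)
open import Relation.Nullary.Decidable using (_×-dec_)
open import Data.Empty using (⊥-elim)
open import Function using (_∘_)

module _ {A : Set} where

  infix 4 _⊑_
  _⊑_ : List A → List A → Set
  xs ⊑ ys = ∃[ zs ] xs ++ zs ≡ ys

  ⊑-refl : ∀ xs → xs ⊑ xs
  ⊑-refl xs = [] , ++-identityʳ xs

  ⊑-∷ : ∀ x {xs ys} → xs ⊑ ys → x ∷ xs ⊑ x ∷ ys
  ⊑-∷ x (zs , refl) = zs , refl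

  ⊑-∷ʳ : ∀ {xs} ys y → xs ⊑ ys → xs ⊑ ys ++ [ y ]
  ⊑-∷ʳ {xs} ys y (zs , refl) = zs ++ [ y ] , sym (++-assoc xs zs [ y ])

  ⊑⇒⊆ : ∀ {xs ys} → xs ⊑ ys → xs ⊆ ys
  ⊑⇒⊆ (zs , refl) = ∈-++⁺ˡ

  unique-⊑ : ∀ {xs ys} → xs ⊑ ys → Unique ys → Unique xs
  unique-⊑ {[]}     _           _        = []
  unique-⊑ {x ∷ xs} (zs , refl) (x∉ ∷ u) = ++⁻ˡ xs x∉ ∷ unique-⊑ (zs , refl) u

  unique-∷ʳ : ∀ {xs x} → Unique xs → x ∉ xs → Unique (xs ++ [ x ])
  unique-∷ʳ {x = x} u x∉ =
    Unique.++⁺ {A = A} {ys = [ x ]} u ([] ∷ []) λ { (x∈ , here refl) → x∉ x∈ }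

  allPairs-map∈ : ∀ {R S : A → A → Set} {xs} →
                  (∀ {x y} → x ∈ xs → y ∈ xs → R x y → S x y) →
                  AllPairs R xs → AllPairs S xs
  allPairs-map∈ f []         = []
  allPairs-map∈ f (rx ∷ rxs) =
    All.tabulate (λ y∈ → f (here refl) (there y∈) (All.lookup rx y∈))
    ∷ allPairs-map∈ (λ x∈ y∈ → f (there x∈) (there y∈)) rxs

  Before : A → A → List A → Set
  Before x y xs = ∃₂ λ us vs → xs ≡ us ++ y ∷ vs × x ∈ us

  before-∷ : ∀ {x y} z {xs} → Before x y xs → Before x y (z ∷ xs)
  before-∷ z (us , vs , refl , x∈) = z ∷ us , vs , refl , there x∈

  before-or-after : ∀ {x y} xs → x ≢ y → x ∈ xs → y ∈ xs →
                    Before x y xs ⊎ Before y x xs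
  before-or-after (z ∷ zs) x≢y (here refl) (here refl) = ⊥-elim (x≢y refl)
  before-or-after (z ∷ zs) _ (here refl) (there y∈)
    with us , vs , refl ← ∈-∃++ y∈ = inj₁ (z ∷ us , vs , refl , here refl)
  before-or-after (z ∷ zs) _ (there x∈) (here refl)
    with us , vs , refl ← ∈-∃++ x∈ = inj₂ (z ∷ us , vs , refl , here refl)
  before-or-after (z ∷ zs) x≢y (there x∈) (there y∈) =
    Sum.map (before-∷ z) (before-∷ z) (before-or-after zs x≢y x∈ y∈)

module _ (G : Multigraph) where
  open Multigraph G
  open DecMembership {A = Fin n} _≟_ using () renaming (_∈?_ to _∈ᵥ?_)
  open DecMembership {A = Fin m} _≟_ using () renaming (_∈?_ to _∈ₑ?_)

  OneOf : Fin m → Fin m → Fin m → Fin m → Set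
  OneOf e f g h = (h ≡ e) ⊎ (h ≡ f) ⊎ (h ≡ g)

  avoid-cut : ∀ {e f g h} → h ≢ e → h ≢ f → h ≢ g → ¬ OneOf e f g h
  avoid-cut h≢e h≢f h≢g = Sum.[ h≢e , Sum.[ h≢f , h≢g ] ]

  joins-sym : ∀ {h x y} → Joins G h x y → Joins G h y x
  joins-sym (inj₁ p) = inj₂ p
  joins-sym (inj₂ p) = inj₁ p

  joins-unique : ∀ {h x y u w} → Joins G h x y → Joins G h u w →
                 (x ≡ u × y ≡ w) ⊎ (x ≡ w × y ≡ u)
  joins-unique (inj₁ p) (inj₁ q) with refl ← trans (sym p) q = inj₁ (refl , refl)
  joins-unique (inj₁ p) (inj₂ q) with refl ← trans (sym p) q = inj₂ (refl , refl)
  joins-unique (inj₂ p) (inj₁ q) with refl ← trans (sym p) q = inj₂ (refl , refl)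
  joins-unique (inj₂ p) (inj₂ q) with refl ← trans (sym p) q = inj₁ (refl , refl)

  reach-trans : ∀ {R a b c} → Reach G R a b → Reach G R b c → Reach G R a c
  reach-trans here              q = q
  reach-trans (step h h∉ j p) q = step h h∉ j (reach-trans p q)

  reach-sym : ∀ {R a b} → Reach G R a b → Reach G R b a
  reach-sym here              = here
  reach-sym (step h h∉ j p) = reach-trans (reach-sym p) (step h h∉ (joins-sym j) here)

  reach-mono : ∀ {R S a b} → (∀ {h} → S h → R h) → Reach G R a b → Reach G S a b
  reach-mono S⇒R here              = here
  reach-mono S⇒R (step h h∉ j p) = step h (λ s → h∉ (S⇒R s)) j (reach-mono S⇒R p)

  module _ {T : List (Fin m)} where

    treePath-∷ʳ : ∀ {x y w es vs h} → TreePath G T x y es vs → h ∈ T →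
                  Joins G h y w → TreePath G T x w (es ++ [ h ]) (vs ++ [ w ])
    treePath-∷ʳ nil              h∈ j′ = cons _ h∈ j′ nil
    treePath-∷ʳ (cons h h∈ j p) k∈ j′ = cons h h∈ j (treePath-∷ʳ p k∈ j′)

    treePath-mono : ∀ {T′ x y es vs} → T ⊆ T′ →
                    TreePath G T x y es vs → TreePath G T′ x y es vs
    treePath-mono T⊆T′ nil              = nil
    treePath-mono T⊆T′ (cons h h∈ j p) = cons h (T⊆T′ h∈) j (treePath-mono T⊆T′ p)

    treePath-edges : ∀ {x y es vs} → TreePath G T x y es vs → es ⊆ T
    treePath-edges (cons h h∈ j p) (here refl) = h∈
    treePath-edges (cons h h∈ j p) (there k∈)  = treePath-edges p k∈

    treePath⇒reach : ∀ {R x y es vs} → TreePath G T x y es vs →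
                     (∀ {h} → h ∈ es → ¬ R h) → Reach G R x y
    treePath⇒reach nil              avoid = here
    treePath⇒reach (cons h h∈ j p) avoid =
      step h (avoid (here refl)) j (treePath⇒reach p (λ k∈ → avoid (there k∈)))

    treePath-++⁻ : ∀ {x z bs vs} as → TreePath G T x z (as ++ bs) vs →
                   ∃₂ λ y us → TreePath G T x y as us × us ⊑ vs
    treePath-++⁻ [] nil              = _ , _ , nil , ⊑-refl _
    treePath-++⁻ [] (cons h h∈ j p)  = _ , _ , nil , (_ , refl)
    treePath-++⁻ (a ∷ as) (cons a a∈ j p) with y , us , p′ , us⊑ ← treePath-++⁻ as p =
      y , _ , cons a a∈ j p′ , ⊑-∷ _ us⊑

    treePath⇒≤T : ∀ {r z us f bs vs e} → TreePath G T r z (us ++ f ∷ bs) vs →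
                  Unique vs → e ∈ us → EdgeLeT G r T e f
    treePath⇒≤T {r} {z} {us} {f} {bs} {vs} p u e∈
      with z′ , vs′ , p′ , vs′⊑ ← treePath-++⁻ (us ++ [ f ])
             (subst (λ es → TreePath G T r z es vs) (sym (++-assoc us [ f ] bs)) p) =
      z′ , us ++ [ f ] , vs′ , us , p′ , unique-⊑ vs′⊑ u , refl , ∈-++⁺ˡ e∈

    treePath⇒comparable : ∀ {r x es vs e f} → TreePath G T r x es vs → Unique vs →
                          e ≢ f → e ∈ es → f ∈ es → ComparableT G r T e f
    treePath⇒comparable {es = es} p u e≢f e∈ f∈ with before-or-after es e≢f e∈ f∈
    ... | inj₁ (_ , _ , refl , e∈us) = inj₁ (treePath⇒≤T p u e∈us)
    ... | inj₂ (_ , _ , refl , f∈us) = inj₂ (treePath⇒≤T p u f∈us)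

  module _ (r : Fin n) where

    record Inv (vis st : List (Fin n)) (T : List (Fin m))
               (pe : Fin n → List (Fin m)) (pv : Fin n → List (Fin n)) : Set where
      field
        path          : ∀ {x} → x ∈ vis → TreePath G T r x (pe x) (pv x)
        path-unique   : ∀ {x} → x ∈ vis → Unique (pv x)
        path-visited  : ∀ {x} → x ∈ vis → pv x ⊆ vis
        root-visited  : r ∈ vis
        path-root     : pe r ≡ []
        tree-edge     : ∀ {h} → h ∈ T → ∃₂ λ u w → Joins G h u w ×
                          u ∈ vis × w ∈ vis × pe w ≡ pe u ++ [ h ]
        finished      : ∀ {v} → v ∈ vis → v ∉ st → ∀ {h y} → Joins G h v y → y ∈ vis
        stack-visited : st ⊆ vis
        stack-chain   : AllPairs (λ u s → pe s ⊑ pe u) st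
        no-cross-edge : ∀ {h x y} → Joins G h x y → x ∈ vis → y ∈ vis →
                          pe x ⊑ pe y ⊎ pe y ⊑ pe x

    init : Inv [ r ] [ r ] [] (λ _ → []) [_]
    init = record
      { path          = λ { (here refl) → nil }
      ; path-unique   = λ _ → [] ∷ []
      ; path-visited  = λ { x∈ (here refl) → x∈ }
      ; root-visited  = here refl
      ; path-root     = refl
      ; tree-edge     = λ ()
      ; finished      = λ v∈ v∉ → ⊥-elim (v∉ v∈)
      ; stack-visited = λ s∈ → s∈
      ; stack-chain   = [] ∷ []
      ; no-cross-edge = λ _ _ _ → inj₁ (⊑-refl [])
      }

    relabel : ∀ {vis st T pe pv pe′ pv′} →
              (∀ {x} → x ∈ vis → pe′ x ≡ pe x) → (∀ {x} → x ∈ vis → pv′ x ≡ pv x) →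
              Inv vis st T pe pv → Inv vis st T pe′ pv′
    relabel {vis} {st} {T} {pe} {pv} {pe′} {pv′} pe≡ pv≡ I = record
      { path          = λ x∈ → subst₂ (TreePath G T r _) (sym (pe≡ x∈)) (sym (pv≡ x∈)) (path x∈)
      ; path-unique   = λ x∈ → subst Unique (sym (pv≡ x∈)) (path-unique x∈)
      ; path-visited  = λ x∈ y∈ → path-visited x∈ (subst (_ ∈_) (pv≡ x∈) y∈)
      ; root-visited  = root-visited
      ; path-root     = trans (pe≡ root-visited) path-root
      ; tree-edge     = tree-edge′
      ; finished      = finished
      ; stack-visited = stack-visited
      ; stack-chain   = allPairs-map∈ (λ u∈ s∈ → relabel-⊑ (stack-visited s∈) (stack-visited u∈))
                                      stack-chain
      ; no-cross-edge = λ j x∈ y∈ →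
          Sum.map (relabel-⊑ x∈ y∈) (relabel-⊑ y∈ x∈) (no-cross-edge j x∈ y∈)
      }
      where
        open Inv I
        relabel-⊑ : ∀ {x y} → x ∈ vis → y ∈ vis → pe x ⊑ pe y → pe′ x ⊑ pe′ y
        relabel-⊑ x∈ y∈ = subst₂ _⊑_ (sym (pe≡ x∈)) (sym (pe≡ y∈))
        tree-edge′ : ∀ {h} → h ∈ T → ∃₂ λ u w → Joins G h u w ×
                       u ∈ vis × w ∈ vis × pe′ w ≡ pe′ u ++ [ h ]
        tree-edge′ {h} h∈ with u , w , j , u∈ , w∈ , pe-w ← tree-edge h∈ =
          u , w , j , u∈ , w∈ ,
          trans (pe≡ w∈) (trans pe-w (cong (_++ [ h ]) (sym (pe≡ u∈))))

    discover : ∀ {vis u st T pe pv e w} → Joins G e u w → w ∉ vis →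
               pe w ≡ pe u ++ [ e ] → pv w ≡ pv u ++ [ w ] →
               Inv vis (u ∷ st) T pe pv → Inv (w ∷ vis) (w ∷ u ∷ st) (e ∷ T) pe pv
    discover {vis} {u} {st} {T} {pe} {pv} {e} {w} j w∉ pe-w pv-w I = record
      { path          = λ { (here refl) → subst₂ (TreePath G (e ∷ T) r w) (sym pe-w) (sym pv-w)
                                            (treePath-∷ʳ (treePath-mono there (path u∈)) (here refl) j)
                          ; (there x∈) → treePath-mono there (path x∈) }
      ; path-unique   = λ { (here refl) → subst Unique (sym pv-w)
                                            (unique-∷ʳ (path-unique u∈) (λ w∈ → w∉ (path-visited u∈ w∈)))
                          ; (there x∈) → path-unique x∈ }
      ; path-visited  = path-visited′
      ; root-visited  = there root-visited
      ; path-root     = path-root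
      ; tree-edge     = λ { (here refl) → u , w , j , there u∈ , here refl , pe-w
                          ; (there h∈) → tree-edge-old h∈ }
      ; finished      = λ { (here refl) w∉st → ⊥-elim (w∉st (here refl))
                          ; (there v∈) v∉st j′ → there (finished v∈ (λ v∈st → v∉st (there v∈st)) j′) }
      ; stack-visited = λ { (here refl) → here refl ; (there s∈) → there (stack-visited s∈) }
      ; stack-chain   = All.tabulate below-w ∷ stack-chain
      ; no-cross-edge = no-cross-edge′
      }
      where
        open Inv I
        u∈ : u ∈ vis
        u∈ = stack-visited (here refl)

        path-visited′ : ∀ {x} → x ∈ w ∷ vis → pv x ⊆ w ∷ vis
        path-visited′ (there x∈) y∈ = there (path-visited x∈ y∈)
        path-visited′ (here refl) y∈ with ∈-++⁻ (pv u) (subst (_ ∈_) pv-w y∈)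
        ... | inj₁ y∈u         = there (path-visited u∈ y∈u)
        ... | inj₂ (here refl) = here refl

        tree-edge-old : ∀ {h} → h ∈ T → ∃₂ λ u′ w′ → Joins G h u′ w′ ×
                          u′ ∈ w ∷ vis × w′ ∈ w ∷ vis × pe w′ ≡ pe u′ ++ [ h ]
        tree-edge-old h∈ with u′ , w′ , j′ , u′∈ , w′∈ , pe-w′ ← tree-edge h∈ =
          u′ , w′ , j′ , there u′∈ , there w′∈ , pe-w′

        below-w : ∀ {s} → s ∈ u ∷ st → pe s ⊑ pe w
        below-w s∈ = subst (_ ⊑_) (sym pe-w) (⊑-∷ʳ (pe u) e (below-u s∈))
          where
            below-u : ∀ {s} → s ∈ u ∷ st → pe s ⊑ pe u
            below-u (here refl) = ⊑-refl (pe u)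
            below-u (there s∈)  = All.lookup (AllPairs.head stack-chain) s∈

        -- A visited neighbour of the newly discovered w is not finished,
        -- so it is still on the stack, i.e. an ancestor of w.
        neighbour-below-w : ∀ {h y} → Joins G h y w → y ∈ vis → pe y ⊑ pe w
        neighbour-below-w {y = y} j′ y∈ with y ∈ᵥ? (u ∷ st)
        ... | yes y∈st = below-w y∈st
        ... | no y∉st  = ⊥-elim (w∉ (finished y∈ y∉st j′))

        no-cross-edge′ : ∀ {h x y} → Joins G h x y → x ∈ w ∷ vis → y ∈ w ∷ vis →
                         pe x ⊑ pe y ⊎ pe y ⊑ pe x
        no-cross-edge′ j′ (here refl) (here refl) = inj₁ (⊑-refl (pe w))
        no-cross-edge′ j′ (here refl) (there y∈)  = inj₂ (neighbour-below-w (joins-sym j′) y∈)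
        no-cross-edge′ j′ (there x∈)  (here refl) = inj₁ (neighbour-below-w j′ x∈)
        no-cross-edge′ j′ (there x∈)  (there y∈)  = no-cross-edge j′ x∈ y∈

    finish : ∀ {vis u st T pe pv} → (∀ h y → Joins G h u y → y ∈ vis) →
             Inv vis (u ∷ st) T pe pv → Inv vis st T pe pv
    finish {vis} {u} {st} u-done I = record
      { path          = path
      ; path-unique   = path-unique
      ; path-visited  = path-visited
      ; root-visited  = root-visited
      ; path-root     = path-root
      ; tree-edge     = tree-edge
      ; finished      = finished′
      ; stack-visited = λ s∈ → stack-visited (there s∈)
      ; stack-chain   = AllPairs.tail stack-chain
      ; no-cross-edge = no-cross-edge
      }
      where
        open Inv I
        finished′ : ∀ {v} → v ∈ vis → v ∉ st → ∀ {h y} → Joins G h v y → y ∈ vis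
        finished′ {v} v∈ v∉st j with v ≟ u
        ... | yes refl = u-done _ _ j
        ... | no v≢u   = finished v∈ (λ { (here v≡u) → v≢u v≡u ; (there v∈st) → v∉st v∈st }) j

    HasInv : DFSState G → Set
    HasInv ⟨ vis , st , T ⟩ = ∃₂ λ pe pv → Inv vis st T pe pv

    step-inv : ∀ {s s′} → DFSStep G s s′ → HasInv s → HasInv s′
    step-inv (advance {vis} {u} e w j w∉) (pe , pv , I) =
      pe′ , pv′ , discover j w∉
        (trans (updateAt-updates w pe) (cong (_++ [ e ]) (sym (unchanged pe u∈))))
        (trans (updateAt-updates w pv) (cong (_++ [ w ]) (sym (unchanged pv u∈))))
        (relabel (unchanged pe) (unchanged pv) I)
      where
        pe′ : Fin n → List (Fin m)
        pe′ = updateAt pe w (λ _ → pe u ++ [ e ])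
        pv′ : Fin n → List (Fin n)
        pv′ = updateAt pv w (λ _ → pv u ++ [ w ])
        u∈ : u ∈ vis
        u∈ = Inv.stack-visited I (here refl)
        unchanged : ∀ {B : Set} (l : Fin n → B) {f : B → B} {x} → x ∈ vis → updateAt l w f x ≡ l x
        unchanged l x∈ = updateAt-minimal _ w l (λ { refl → w∉ x∈ })
    step-inv (retreat u-done) (pe , pv , I) = pe , pv , finish u-done I

    run-inv : ∀ {s s′} → Star (DFSStep G) s s′ → HasInv s → HasInv s′
    run-inv ε         I = I
    run-inv (st ◅ sts) I = run-inv sts (step-inv st I)

    connected⇒all-visited : ∀ {vis T pe pv} → Connected G → Inv vis [] T pe pv → ∀ v → v ∈ vis
    connected⇒all-visited {vis} conn I v = reach-visited (conn r v) (Inv.root-visited I)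
      where
        reach-visited : ∀ {R a b} → Reach G R a b → a ∈ vis → b ∈ vis
        reach-visited here            a∈ = a∈
        reach-visited (step h _ j p) a∈ = reach-visited p (Inv.finished I a∈ (λ ()) j)

    module Complete {vis T pe pv} (I : Inv vis [] T pe pv) (all-visited : ∀ v → v ∈ vis) where
      open Inv I

      tree-edge-on-path : ∀ {h x y} → h ∈ T → Joins G h x y → h ∈ pe x ⊎ h ∈ pe y
      tree-edge-on-path {h} h∈ j′ with u , w , j , _ , _ , pe-w ← tree-edge h∈ | joins-unique j′ j
      ... | inj₁ (refl , refl) = inj₂ (subst (h ∈_) (sym pe-w) (∈-++⁺ʳ (pe u) (here refl)))
      ... | inj₂ (refl , refl) = inj₁ (subst (h ∈_) (sym pe-w) (∈-++⁺ʳ (pe u) (here refl)))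

      reach-root-avoiding : ∀ {e f g x} → g ∉ T → e ∉ pe x → f ∉ pe x → Reach G (OneOf e f g) x r
      reach-root-avoiding {x = x} g∉T e∉x f∉x = reach-sym (treePath⇒reach p λ k∈ →
        avoid-cut (λ { refl → e∉x k∈ }) (λ { refl → f∉x k∈ }) (λ { refl → g∉T (treePath-edges p k∈) }))
        where
          p : TreePath G T r x (pe x) (pv x)
          p = path (all-visited x)

      module _ {e f g} (f∈T : f ∈ T) (g∉T : g ∉ T) (apart : ∀ {x} → e ∈ pe x → f ∉ pe x) where

        escape : ∀ {x} → Reach G (λ h → (h ≡ e) ⊎ (h ≡ g)) x r → e ∈ pe x →
                 Reach G (OneOf e f g) x r
        escape here e∈r = ⊥-elim (subst (λ l → e ∉ l) (sym path-root) (λ ()) e∈r)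
        escape {x} (step {w = w} h h∉ j rest) e∈x with e ∈ₑ? pe w
        ... | yes e∈w = step h (avoid-cut (h∉ ∘ inj₁) h≢f (h∉ ∘ inj₂)) j (escape rest e∈w)
          where
            h≢f : h ≢ f
            h≢f refl = Sum.[ apart e∈x , apart e∈w ] (tree-edge-on-path f∈T j)
        ... | no e∉w with no-cross-edge j (all-visited x) (all-visited w)
        ...   | inj₁ x⊑w = ⊥-elim (e∉w (⊑⇒⊆ x⊑w e∈x))
        ...   | inj₂ w⊑x = step h (avoid-cut (h∉ ∘ inj₁) h≢f (h∉ ∘ inj₂)) j
                                (reach-root-avoiding g∉T e∉w (apart e∈x ∘ ⊑⇒⊆ w⊑x))
          where
            h≢f : h ≢ f
            h≢f refl = Sum.[ apart e∈x , apart e∈x ∘ ⊑⇒⊆ w⊑x ] (tree-edge-on-path f∈T j)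

      cut-edges-comparable : ∀ {e f g} → (∀ e₁ e₂ → ConnectedWithout G (λ x → (x ≡ e₁) ⊎ (x ≡ e₂))) →
                             e ≢ f → e ∈ T → f ∈ T → g ∉ T →
                             ¬ ConnectedWithout G (OneOf e f g) → ComparableT G r T e f
      cut-edges-comparable {e} {f} {g} conn₂ e≢f e∈T f∈T g∉T disconnected
        with any? (λ x → (e ∈ₑ? pe x) ×-dec (f ∈ₑ? pe x))
      ... | yes (x , e∈x , f∈x) =
        treePath⇒comparable (path (all-visited x)) (path-unique (all-visited x)) e≢f e∈x f∈x
      ... | no apart = ⊥-elim (disconnected λ u v → reach-trans (to-root u) (reach-sym (to-root v)))
        where
          swap : ∀ {h} → OneOf e f g h → OneOf f e g h
          swap = Sum.[ inj₂ ∘ inj₁ , Sum.[ inj₁ , inj₂ ∘ inj₂ ] ]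
          to-root : ∀ v → Reach G (OneOf e f g) v r
          to-root v with e ∈ₑ? pe v | f ∈ₑ? pe v
          ... | yes e∈v | _       = escape f∈T g∉T (λ e∈ f∈ → apart (_ , e∈ , f∈)) (conn₂ e g v r) e∈v
          ... | no _    | yes f∈v = reach-mono swap
                                      (escape e∈T g∉T (λ f∈ e∈ → apart (_ , e∈ , f∈)) (conn₂ f g v r) f∈v)
          ... | no e∉v  | no f∉v  = reach-root-avoiding g∉T e∉v f∉v

lemma4p6 : (G : Multigraph) → ThreeEdgeConnected G →
    (r : Fin (Multigraph.n G)) (T : List (Fin (Multigraph.m G))) →
    IsDFSTree G r T →
    (e f g : Fin (Multigraph.m G)) → e ∈ T → f ∈ T → g ∉ T →
    ThreeEdgeCut G e f g →
    ComparableT G r T e f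
lemma4p6 G (conn , conn₂) r T (_ , dfs) e f g e∈T f∈T g∉T (e≢f , _ , _ , disconnected)
  with pe , pv , I ← run-inv G r dfs (_ , _ , init G r) =
  Complete.cut-edges-comparable G r I (connected⇒all-visited G r conn I)
    conn₂ e≢f e∈T f∈T g∉T disconnected
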